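{- Let $k\geq1$ and let $G$ be a $k$-tree. Then $G$ has a nonempty independent set $S$ of $k$-simplicial vertices such that either (a) $G- S\cong K_k$ (so $G$ is obtained from a $k$-clique by adding $|S|$ pairwise nonadjacent vertices each adjacent to all vertices of the clique), or (b) $G- S$ is a $k$-tree containing a $k$-simplicial vertex $v$ such that: for each $w\in S$ there is exactly one vertex $u\in N_{G- S}(v)$ with $N_G(w)=N_{G- S}[v]\setminus\{u\}$; and every $k$-simplicial vertex of $G$ that is not in $S$ is not adjacent to $v$.
   Context: Graphs are finite and simple. $N_G(v)$ is the set of neighbours of $v$ in $G$ and $N_G[v]=N_G(v)\cup\{v\}$. A vertex $v$ is $k$-simplicial if $N_G(v)$ is a clique of size $k$. A $k$-tree is defined recursively: $K_{k+1}$ is a $k$-tree, and if $G$ has a $k$-simplicial vertex $v$ and $G-v$ is a $k$-tree then $G$ is a $k$-tree. -}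

module Defs where

open import Data.Nat using (ℕ; suc)
open import Data.Bool using (Bool; true; false; _∧_)
open import Data.Fin using (Fin)
open import Data.Fin.Subset using (Subset; _∈_; _∉_; ∣_∣; _-_)
open import Data.Vec using (tabulate; lookup)
open import Relation.Binary.PropositionalEquality using (_≡_; _≢_)
open import Data.Product using (_×_)
import Data.Empty

record Graph (n : ℕ) : Set where
  field
    adj    : Fin n → Fin n → Bool
    sym    : ∀ x y → adj x y ≡ adj y x
    irrefl : ∀ x → adj x x ≡ false

open Graph public

module _ {n : ℕ} (G : Graph n) where

  Adj : Fin n → Fin n → Set
  Adj x y = adj G x y ≡ true

  -- N_{G[U]}(v): neighbours of v inside the vertex set U (induced subgraph G[U]).
  nbr : Subset n → Fin n → Subset n
  nbr U v = tabulate (λ w → lookup U w ∧ adj G v w)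

  IsClique : Subset n → Set
  IsClique C = ∀ x y → x ∈ C → y ∈ C → x ≢ y → Adj x y

  IsIndependent : Subset n → Set
  IsIndependent S = ∀ x y → x ∈ S → y ∈ S → ¬Adj x y
    where
    ¬Adj : Fin n → Fin n → Set
    ¬Adj a b = Adj a b → Data.Empty.⊥

  Simplicial : ℕ → Subset n → Fin n → Set
  Simplicial k U v = v ∈ U × IsClique (nbr U v) × ∣ nbr U v ∣ ≡ k

  data KTree (k : ℕ) : Subset n → Set where
    base : ∀ U → ∣ U ∣ ≡ suc k → IsClique U → KTree k U
    step : ∀ U v → Simplicial k U v → KTree k (U - v) → KTree k U

-- Two simplicial vertices x, y of a k-tree G with at least k + 2 vertices are never
-- adjacent: G - y is again a k-tree, so x has degree at least k in it, whereas losing the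
-- neighbour y would leave x only k - 1.  Hence deleting simplicial vertices one at a time
-- never changes the neighbourhood of the remaining ones, and leaves a k-tree or a k-clique.
-- If G is K_{k+1}, take S = {x}.  Otherwise delete the set L of all simplicial vertices; if
-- a k-tree remains, pick v simplicial in it and let S be the neighbours of v in L (nonempty,
-- or v would be simplicial in G).  For w ∈ S, N(w) is a k-clique through v avoiding S, so it
-- lies in N_{G-S}[v], of size k + 1, and misses exactly one u ≠ v; and a simplicial vertex
-- of G adjacent to v lies in L, hence in S.

module Submission where

open import Defs

open import Data.Bool using (Bool; true; _∧_)
open import Data.Bool.Properties using (T-≡)
open import Data.Empty using (⊥; ⊥-elim)
open import Data.Fin using (Fin; zero; suc; _≟_)
open import Data.Fin.Properties using (any?; all?)
open import Data.Fin.Subset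
  using (Subset; ⊤; _∈_; _∉_; _⊆_; _⊂_; _─_; _∪_; _-_; ⁅_⁆; ∣_∣; Nonempty; outside; inside)
  renaming (⊥ to ∅)
open import Data.Fin.Subset.Induction using (⊂-wellFounded)
open import Data.Fin.Subset.Properties
open import Data.Nat using (ℕ; suc; _≤_; _<_; _≥_; z≤n; s≤s)
open import Data.Nat.Properties
  using (module ≤-Reasoning; <-irrefl; <-trans; <-≤-trans; ≤-trans; suc-injective; ≤-reflexive; 1+n≢n; m≤n⇒m<n∨m≡n)
open import Data.Product using (Σ; _×_; _,_; proj₁; proj₂; ∃; map₁; map₂)
open import Data.Sum using (_⊎_; inj₁; inj₂; [_,_]′)
open import Data.Vec using (_∷_; here; there; tabulate)
open import Data.Vec.Properties using ([]=⇒lookup; lookup⇒[]=; lookup∘tabulate)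
open import Function using (_∘_; id; case_of_)
open import Function.Bundles using (Equivalence)
open import Induction.WellFounded using (WfRec; module All)
open import Relation.Nullary using (¬_; yes; no)
open import Relation.Nullary.Decidable
  using (Dec; does; _×-dec_; ¬?; _→-dec_; toWitness; dec-true; isYes≗does)
open import Relation.Binary.PropositionalEquality
  using (_≡_; _≢_; refl; trans; cong; cong₂; subst; subst₂; ≢-sym)
import Relation.Binary.PropositionalEquality as ≡

private variable
  n : ℕ
  p q : Subset n
  x y : Fin n

x∈p─q⇒x∉q : x ∈ p ─ q → x ∉ q
x∈p─q⇒x∉q {p = _ ∷ _} {q = outside ∷ _} here        ()
x∈p─q⇒x∉q {p = _ ∷ _} {q = _ ∷ _}       (there x∈) (there x∈q) = x∈p─q⇒x∉q x∈ x∈q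

x∈p-y⇒x∈p : x ∈ p - y → x ∈ p
x∈p-y⇒x∈p {p = p} {y = y} = p─q⊆p p ⁅ y ⁆

x∈p-y⇒x≢y : x ∈ p - y → x ≢ y
x∈p-y⇒x≢y {y = y} x∈ refl = x∈p─q⇒x∉q x∈ (x∈⁅x⁆ y)

x∈p⇒suc∣p-x∣≡∣p∣ : x ∈ p → suc ∣ p - x ∣ ≡ ∣ p ∣
x∈p⇒suc∣p-x∣≡∣p∣ {p = inside ∷ p} here = cong suc (cong ∣_∣ (p─⊥≡p p))
x∈p⇒suc∣p-x∣≡∣p∣ {p = inside  ∷ _} (there x∈p) = cong suc (x∈p⇒suc∣p-x∣≡∣p∣ x∈p)
x∈p⇒suc∣p-x∣≡∣p∣ {p = outside ∷ _} (there x∈p) = x∈p⇒suc∣p-x∣≡∣p∣ x∈p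

∣p∣≡1+m⇒∣p-x∣≡m : ∀ {m} → x ∈ p → ∣ p ∣ ≡ suc m → ∣ p - x ∣ ≡ m
∣p∣≡1+m⇒∣p-x∣≡m x∈p ∣p∣≡1+m = suc-injective (trans (x∈p⇒suc∣p-x∣≡∣p∣ x∈p) ∣p∣≡1+m)

x∈p⇒p-x∪⁅x⁆≡p : x ∈ p → (p - x) ∪ ⁅ x ⁆ ≡ p
x∈p⇒p-x∪⁅x⁆≡p {p = inside ∷ p} here = cong (inside ∷_) (trans (∪-identityʳ (p ─ ∅)) (p─⊥≡p p))
x∈p⇒p-x∪⁅x⁆≡p {p = inside  ∷ _} (there x∈p) = cong (inside ∷_) (x∈p⇒p-x∪⁅x⁆≡p x∈p)
x∈p⇒p-x∪⁅x⁆≡p {p = outside ∷ _} (there x∈p) = cong (outside ∷_) (x∈p⇒p-x∪⁅x⁆≡p x∈p)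

x∉p⇒∣p∪⁅x⁆∣≡suc∣p∣ : x ∉ p → ∣ p ∪ ⁅ x ⁆ ∣ ≡ suc ∣ p ∣
x∉p⇒∣p∪⁅x⁆∣≡suc∣p∣ {x = zero}  {p = outside ∷ p} x∉p = cong suc (cong ∣_∣ (∪-identityʳ p))
x∉p⇒∣p∪⁅x⁆∣≡suc∣p∣ {x = zero}  {p = inside  ∷ p} x∉p = ⊥-elim (x∉p here)
x∉p⇒∣p∪⁅x⁆∣≡suc∣p∣ {x = suc x} {p = outside ∷ p} x∉p = x∉p⇒∣p∪⁅x⁆∣≡suc∣p∣ (λ x∈p → x∉p (there x∈p))
x∉p⇒∣p∪⁅x⁆∣≡suc∣p∣ {x = suc x} {p = inside  ∷ p} x∉p = cong suc (x∉p⇒∣p∪⁅x⁆∣≡suc∣p∣ (λ x∈p → x∉p (there x∈p)))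

p⊆q⇒∣q∣≤∣p∣⇒q⊆p : p ⊆ q → ∣ q ∣ ≤ ∣ p ∣ → q ⊆ p
p⊆q⇒∣q∣≤∣p∣⇒q⊆p {p = p} p⊆q ∣q∣≤∣p∣ {x} x∈q with x ∈? p
... | yes x∈p = x∈p
... | no  x∉p = ⊥-elim (<-irrefl refl (<-≤-trans (p⊂q⇒∣p∣<∣q∣ (p⊆q , x , x∈q , x∉p)) ∣q∣≤∣p∣))

∣p∣<∣q∣⇒∃-∈q-∉p : ∣ p ∣ < ∣ q ∣ → ∃ λ x → x ∈ q × x ∉ p
∣p∣<∣q∣⇒∃-∈q-∉p {p = p} {q = q} ∣p∣<∣q∣ with any? (λ x → (x ∈? q) ×-dec ¬? (x ∈? p))
... | yes found = found
... | no  none  = ⊥-elim (<-irrefl refl (<-≤-trans ∣p∣<∣q∣ (p⊆q⇒∣p∣≤∣q∣ q⊆p)))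
  where
  q⊆p : q ⊆ p
  q⊆p {x} x∈q with x ∈? p
  ... | yes x∈p = x∈p
  ... | no  x∉p = ⊥-elim (none (x , x∈q , x∉p))

∣p∣≡1+m⇒Nonempty : ∀ {n} {p : Subset n} {m} → ∣ p ∣ ≡ suc m → Nonempty p
∣p∣≡1+m⇒Nonempty {n} {p} ∣p∣≡1+m =
  map₂ proj₁ (∣p∣<∣q∣⇒∃-∈q-∉p {p = ∅} {q = p} (subst₂ _<_ (≡.sym (∣⊥∣≡0 n)) (≡.sym ∣p∣≡1+m) (s≤s z≤n)))

p-x≡p-y⇒x≡y : x ∈ p → p - x ≡ p - y → x ≡ y
p-x≡p-y⇒x≡y {x = x} {y = y} x∈p p-x≡p-y with x ≟ y
... | yes x≡y = x≡y
... | no  x≢y = ⊥-elim (x∈p-y⇒x≢y (subst (x ∈_) (≡.sym p-x≡p-y) (x∈p∧x≢y⇒x∈p-y x∈p x≢y)) refl)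

p⊆q∧suc∣p∣≡∣q∣⇒p≡q-x : p ⊆ q → suc ∣ p ∣ ≡ ∣ q ∣ → ∃ λ x → x ∈ q × p ≡ q - x
p⊆q∧suc∣p∣≡∣q∣⇒p≡q-x {p = p} {q = q} p⊆q ∣q∣≡1+∣p∣ with ∣p∣<∣q∣⇒∃-∈q-∉p (≤-reflexive ∣q∣≡1+∣p∣)
... | x , x∈q , x∉p = x , x∈q , ⊆-antisym p⊆q-x (p⊆q⇒∣q∣≤∣p∣⇒q⊆p p⊆q-x (≤-reflexive ∣q-x∣≡∣p∣))
  where
  p⊆q-x : p ⊆ q - x
  p⊆q-x z∈p = x∈p∧x≢y⇒x∈p-y (p⊆q z∈p) λ { refl → x∉p z∈p }
  ∣q-x∣≡∣p∣ : ∣ q - x ∣ ≡ ∣ p ∣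
  ∣q-x∣≡∣p∣ = ∣p∣≡1+m⇒∣p-x∣≡m x∈q (≡.sym ∣q∣≡1+∣p∣)

q⊆p∪⁅v⁆⇒q≡p∪⁅v⁆-u : ∀ {v} → v ∉ p → v ∈ q → q ⊆ p ∪ ⁅ v ⁆ → ∣ q ∣ ≡ ∣ p ∣ →
  Σ (Fin n) λ u → (u ∈ p × q ≡ (p ∪ ⁅ v ⁆) - u) ×
                  (∀ u′ → u′ ∈ p → q ≡ (p ∪ ⁅ v ⁆) - u′ → u′ ≡ u)
q⊆p∪⁅v⁆⇒q≡p∪⁅v⁆-u {p = p} {q = q} {v} v∉p v∈q q⊆p∪v ∣q∣≡∣p∣
  with p⊆q∧suc∣p∣≡∣q∣⇒p≡q-x q⊆p∪v (trans (cong suc ∣q∣≡∣p∣) (≡.sym (x∉p⇒∣p∪⁅x⁆∣≡suc∣p∣ v∉p)))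
... | u , u∈p∪v , q≡p∪v-u = u , (u∈p , q≡p∪v-u) , unique
  where
  u∈p : u ∈ p
  u∈p with x∈p∪q⁻ p ⁅ v ⁆ u∈p∪v
  ... | inj₁ u∈p = u∈p
  ... | inj₂ u∈v = ⊥-elim (x∈p-y⇒x≢y (subst (v ∈_) q≡p∪v-u v∈q) (≡.sym (x∈⁅y⁆⇒x≡y v u∈v)))
  unique : ∀ u′ → u′ ∈ p → q ≡ (p ∪ ⁅ v ⁆) - u′ → u′ ≡ u
  unique u′ u′∈p q≡p∪v-u′ = p-x≡p-y⇒x≡y (p⊆p∪q ⁅ v ⁆ u′∈p) (trans (≡.sym q≡p∪v-u′) q≡p∪v-u)

∈tabulate⁻ : ∀ {f : Fin n → Bool} → x ∈ tabulate f → f x ≡ true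
∈tabulate⁻ {x = x} {f = f} x∈ = trans (≡.sym (lookup∘tabulate f x)) ([]=⇒lookup x∈)

∈tabulate⁺ : ∀ {f : Fin n → Bool} → f x ≡ true → x ∈ tabulate f
∈tabulate⁺ {x = x} {f = f} fx≡true = lookup⇒[]= x _ (trans (lookup∘tabulate f x) fx≡true)

∧≡true⁻ : ∀ {a b} → a ∧ b ≡ true → a ≡ true × b ≡ true
∧≡true⁻ {true} {true} refl = refl , refl

module GraphProperties {n : ℕ} (G : Graph n) where

  private variable
    C U U′ : Subset n
    v w : Fin n

  Adj-sym : Adj G x y → Adj G y x
  Adj-sym {x} {y} x~y = trans (Graph.sym G y x) x~y

  Adj⇒≢ : Adj G x y → x ≢ y
  Adj⇒≢ {x} x~x refl with trans (≡.sym x~x) (irrefl G x)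
  ... | ()

  ∈nbr⁻ : w ∈ nbr G U v → w ∈ U × Adj G v w
  ∈nbr⁻ {w} {U} w∈ = map₁ (lookup⇒[]= w U) (∧≡true⁻ (∈tabulate⁻ w∈))

  ∈nbr⁺ : w ∈ U → Adj G v w → w ∈ nbr G U v
  ∈nbr⁺ w∈U v~w = ∈tabulate⁺ (cong₂ _∧_ ([]=⇒lookup w∈U) v~w)

  nbr⊆U-v : nbr G U v ⊆ U - v
  nbr⊆U-v w∈ = let (w∈U , v~w) = ∈nbr⁻ w∈ in x∈p∧x≢y⇒x∈p-y w∈U (Adj⇒≢ (Adj-sym v~w))

  nbr-mono : U ⊆ U′ → nbr G U v ⊆ nbr G U′ v
  nbr-mono U⊆U′ w∈ = let (w∈U , v~w) = ∈nbr⁻ w∈ in ∈nbr⁺ (U⊆U′ w∈U) v~w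

  nbr-remove : nbr G (U - y) v ⊆ nbr G U v - y
  nbr-remove {U = U} {y = y} w∈ = let (w∈U-y , v~w) = ∈nbr⁻ {U = U - y} w∈ in
    x∈p∧x≢y⇒x∈p-y (∈nbr⁺ (x∈p-y⇒x∈p w∈U-y) v~w) (x∈p-y⇒x≢y w∈U-y)

  nbr-restrict : U′ ⊆ U → (∀ {w} → w ∈ U → Adj G v w → w ∈ U′) → nbr G U′ v ≡ nbr G U v
  nbr-restrict U′⊆U closed =
    ⊆-antisym (nbr-mono U′⊆U) (λ w∈ → let (w∈U , v~w) = ∈nbr⁻ w∈ in ∈nbr⁺ (closed w∈U v~w) v~w)

  IsClique? : ∀ C → Dec (IsClique G C)
  IsClique? C = all? λ x → all? λ y →
    (x ∈? C) →-dec ((y ∈? C) →-dec (¬? (x ≟ y) →-dec (adj G x y Data.Bool.≟ true)))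

  IsClique-⊆ : U ⊆ C → IsClique G C → IsClique G U
  IsClique-⊆ U⊆C clique x y x∈U y∈U = clique x y (U⊆C x∈U) (U⊆C y∈U)

  IsClique⇒suc∣nbr∣≡∣C∣ : IsClique G C → x ∈ C → suc ∣ nbr G C x ∣ ≡ ∣ C ∣
  IsClique⇒suc∣nbr∣≡∣C∣ {C} {x} clique x∈C = trans (cong (suc ∘ ∣_∣) nbr≡C-x) (x∈p⇒suc∣p-x∣≡∣p∣ x∈C)
    where
    nbr≡C-x : nbr G C x ≡ C - x
    nbr≡C-x = ⊆-antisym nbr⊆U-v λ y∈ →
      ∈nbr⁺ (x∈p-y⇒x∈p y∈) (clique x _ x∈C (x∈p-y⇒x∈p y∈) (≢-sym (x∈p-y⇒x≢y y∈)))

  IsClique-insert : IsClique G (C - y) → (∀ {x} → x ∈ C - y → Adj G y x) → IsClique G C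
  IsClique-insert {y = y} clique y~ a b a∈C b∈C a≢b with a ≟ y | b ≟ y
  ... | yes refl | yes refl = ⊥-elim (a≢b refl)
  ... | yes refl | no  b≢y  = y~ (x∈p∧x≢y⇒x∈p-y b∈C b≢y)
  ... | no  a≢y  | yes refl = Adj-sym (y~ (x∈p∧x≢y⇒x∈p-y a∈C a≢y))
  ... | no  a≢y  | no  b≢y  = clique a b (x∈p∧x≢y⇒x∈p-y a∈C a≢y) (x∈p∧x≢y⇒x∈p-y b∈C b≢y) a≢b

  IsIndependent-⁅x⁆ : IsIndependent G ⁅ x ⁆
  IsIndependent-⁅x⁆ {x} a b a∈ b∈ a~b = Adj⇒≢ a~b (trans (x∈⁅y⁆⇒x≡y x a∈) (≡.sym (x∈⁅y⁆⇒x≡y x b∈)))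

module KTreeProperties {n : ℕ} (G : Graph n) (k : ℕ) where

  open GraphProperties G

  private variable
    C U U′ : Subset n
    v : Fin n

  KClique : Subset n → Set
  KClique C = ∣ C ∣ ≡ k × IsClique G C

  Simplicial-resp-nbr : v ∈ U′ → nbr G U′ v ≡ nbr G U v → Simplicial G k U v → Simplicial G k U′ v
  Simplicial-resp-nbr v∈U′ nbr≡ (_ , clique , ∣nbr∣≡k) =
    v∈U′ , subst (IsClique G) (≡.sym nbr≡) clique , trans (cong ∣_∣ nbr≡) ∣nbr∣≡k

  Simplicial-remove-¬Adj : x ≢ y → ¬ Adj G x y → Simplicial G k U x → Simplicial G k (U - y) x
  Simplicial-remove-¬Adj {y = y} {U = U} x≢y x≁y sx@(x∈U , _) =
    Simplicial-resp-nbr (x∈p∧x≢y⇒x∈p-y x∈U x≢y) (nbr-restrict (p─q⊆p U ⁅ y ⁆) closed) sx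
    where
    closed : ∀ {w} → w ∈ U → Adj G _ w → w ∈ U - y
    closed w∈U x~w = x∈p∧x≢y⇒x∈p-y w∈U λ { refl → x≁y x~w }

  KClique⇒¬Simplicial : KClique C → ¬ Simplicial G k C x
  KClique⇒¬Simplicial (∣C∣≡k , clique) (x∈C , _ , ∣nbr∣≡k) =
    1+n≢n (trans (IsClique⇒suc∣nbr∣≡∣C∣ clique x∈C) (trans ∣C∣≡k (≡.sym ∣nbr∣≡k)))

  KTree⇒k≤degree : KTree G k U → x ∈ U → k ≤ ∣ nbr G U x ∣
  KTree⇒k≤degree (base U ∣U∣≡1+k clique) x∈U =
    ≤-reflexive (suc-injective (trans (≡.sym ∣U∣≡1+k) (≡.sym (IsClique⇒suc∣nbr∣≡∣C∣ clique x∈U))))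
  KTree⇒k≤degree {x = x} (step U y (_ , _ , ∣nbr∣≡k) t) x∈U with x ≟ y
  ... | yes refl = ≤-reflexive (≡.sym ∣nbr∣≡k)
  ... | no  x≢y  = ≤-trans (KTree⇒k≤degree t (x∈p∧x≢y⇒x∈p-y x∈U x≢y))
                           (p⊆q⇒∣p∣≤∣q∣ (nbr-mono {U = U - y} (p─q⊆p U ⁅ y ⁆)))

  KTree⇒k<∣U∣ : KTree G k U → k < ∣ U ∣
  KTree⇒k<∣U∣ (base _ ∣U∣≡1+k _)   = ≤-reflexive (≡.sym ∣U∣≡1+k)
  KTree⇒k<∣U∣ (step _ _ (y∈U , _) t) = <-trans (KTree⇒k<∣U∣ t) (x∈p⇒∣p-x∣<∣p∣ y∈U)

  KTree∧∣U∣≡1+k⇒IsClique : KTree G k U → ∣ U ∣ ≡ suc k → IsClique G U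
  KTree∧∣U∣≡1+k⇒IsClique {U} t ∣U∣≡1+k x y x∈U y∈U x≢y = proj₂ (∈nbr⁻ {U = U} (U-x⊆nbr y∈U-x))
    where
    y∈U-x : y ∈ U - x
    y∈U-x = x∈p∧x≢y⇒x∈p-y y∈U (≢-sym x≢y)
    U-x⊆nbr : U - x ⊆ nbr G U x
    U-x⊆nbr = p⊆q⇒∣q∣≤∣p∣⇒q⊆p nbr⊆U-v
      (≤-trans (≤-reflexive (∣p∣≡1+m⇒∣p-x∣≡m x∈U ∣U∣≡1+k)) (KTree⇒k≤degree t x∈U))

  KTree∧∣U∣≡1+k⇒KClique[U-x] : KTree G k U → ∣ U ∣ ≡ suc k → x ∈ U → KClique (U - x)
  KTree∧∣U∣≡1+k⇒KClique[U-x] {U} t ∣U∣≡1+k x∈U =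
    ∣p∣≡1+m⇒∣p-x∣≡m x∈U ∣U∣≡1+k ,
    IsClique-⊆ (p─q⊆p U _) (KTree∧∣U∣≡1+k⇒IsClique t ∣U∣≡1+k)

  KTree⇒∃Simplicial : KTree G k U → ∃ (Simplicial G k U)
  KTree⇒∃Simplicial (base U ∣U∣≡1+k clique) with ∣p∣≡1+m⇒Nonempty ∣U∣≡1+k
  ... | x , x∈U = x , x∈U , IsClique-⊆ (proj₁ ∘ ∈nbr⁻) clique ,
                  suc-injective (trans (IsClique⇒suc∣nbr∣≡∣C∣ clique x∈U) ∣U∣≡1+k)
  KTree⇒∃Simplicial (step U y sy _) = y , sy

  KTree[U-y]⇒¬Adj-Simplicial : y ∈ U → KTree G k (U - y) → Simplicial G k U x → ¬ Adj G x y
  KTree[U-y]⇒¬Adj-Simplicial {y} {U} {x} y∈U t (x∈U , _ , ∣nbr∣≡k) x~y = <-irrefl refl (begin-strict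
    k                       ≤⟨ KTree⇒k≤degree t (x∈p∧x≢y⇒x∈p-y x∈U (Adj⇒≢ x~y)) ⟩
    ∣ nbr G (U - y) x ∣     ≤⟨ p⊆q⇒∣p∣≤∣q∣ {p = nbr G (U - y) x} (nbr-remove {U = U}) ⟩
    ∣ nbr G U x - y ∣       <⟨ x∈p⇒∣p-x∣<∣p∣ (∈nbr⁺ y∈U x~y) ⟩
    ∣ nbr G U x ∣           ≡⟨ ∣nbr∣≡k ⟩
    k                       ∎)
    where open ≤-Reasoning

  IsClique-exchange : IsClique G (U - y) → ∣ U - y ∣ ≡ suc k → Simplicial G k U y →
                      x ∈ U - y → ¬ Adj G y x → IsClique G (U - x)
  IsClique-exchange {U} {y} {x} clique ∣U-y∣≡1+k (_ , _ , ∣nbr∣≡k) x∈U-y y≁x =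
    IsClique-insert (subst (IsClique G) (≡.sym U-x-y≡U-y-x) (IsClique-⊆ (p─q⊆p (U - y) _) clique))
                    (λ b∈ → proj₂ (∈nbr⁻ {U = U} (U-y-x⊆nbr (subst (_ ∈_) U-x-y≡U-y-x b∈))))
    where
    U-x-y≡U-y-x : U - x - y ≡ U - y - x
    U-x-y≡U-y-x = p─x─y≡p─y─x U x y
    nbr⊆U-y-x : nbr G U y ⊆ U - y - x
    nbr⊆U-y-x w∈ = x∈p∧x≢y⇒x∈p-y (nbr⊆U-v w∈) λ { refl → y≁x (proj₂ (∈nbr⁻ {U = U} w∈)) }
    ∣U-y-x∣≡k : ∣ U - y - x ∣ ≡ k
    ∣U-y-x∣≡k = ∣p∣≡1+m⇒∣p-x∣≡m x∈U-y ∣U-y∣≡1+k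
    U-y-x⊆nbr : U - y - x ⊆ nbr G U y
    U-y-x⊆nbr = p⊆q⇒∣q∣≤∣p∣⇒q⊆p nbr⊆U-y-x (≤-reflexive (trans ∣U-y-x∣≡k (≡.sym ∣nbr∣≡k)))

  KTree-remove-Simplicial : KTree G k U → Simplicial G k U x → suc k < ∣ U ∣ → KTree G k (U - x)
  KTree-remove-Simplicial (base _ ∣U∣≡1+k _) _ 1+k<∣U∣ = ⊥-elim (<-irrefl (≡.sym ∣U∣≡1+k) 1+k<∣U∣)
  KTree-remove-Simplicial {x = x} (step U y sy@(y∈U , _) t) sx _ with x ≟ y
  ... | yes refl = t
  ... | no  x≢y  = remove-nonadjacent (m≤n⇒m<n∨m≡n (KTree⇒k<∣U∣ t))
    where
    x≁y : ¬ Adj G x y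
    x≁y = KTree[U-y]⇒¬Adj-Simplicial y∈U t sx
    x∈U-y : x ∈ U - y
    x∈U-y = x∈p∧x≢y⇒x∈p-y (proj₁ sx) x≢y
    remove-nonadjacent : suc k < ∣ U - y ∣ ⊎ suc k ≡ ∣ U - y ∣ → KTree G k (U - x)
    remove-nonadjacent (inj₁ 1+k<∣U-y∣) =
      step (U - x) y (Simplicial-remove-¬Adj (≢-sym x≢y) (x≁y ∘ Adj-sym) sy)
           (subst (KTree G k) (p─x─y≡p─y─x U y x)
                  (KTree-remove-Simplicial t (Simplicial-remove-¬Adj x≢y x≁y sx) 1+k<∣U-y∣))
    remove-nonadjacent (inj₂ 1+k≡∣U-y∣) =
      base (U - x) (∣p∣≡1+m⇒∣p-x∣≡m (proj₁ sx) ∣U∣≡2+k)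
           (IsClique-exchange (KTree∧∣U∣≡1+k⇒IsClique t ∣U-y∣≡1+k) ∣U-y∣≡1+k sy x∈U-y (x≁y ∘ Adj-sym))
      where
      ∣U-y∣≡1+k : ∣ U - y ∣ ≡ suc k
      ∣U-y∣≡1+k = ≡.sym 1+k≡∣U-y∣
      ∣U∣≡2+k : ∣ U ∣ ≡ suc (suc k)
      ∣U∣≡2+k = trans (≡.sym (x∈p⇒suc∣p-x∣≡∣p∣ y∈U)) (cong suc ∣U-y∣≡1+k)

  KTree-remove-Simplicial′ : KTree G k U → Simplicial G k U x → KTree G k (U - x) ⊎ KClique (U - x)
  KTree-remove-Simplicial′ t sx with m≤n⇒m<n∨m≡n (KTree⇒k<∣U∣ t)
  ... | inj₁ 1+k<∣U∣ = inj₁ (KTree-remove-Simplicial t sx 1+k<∣U∣)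
  ... | inj₂ 1+k≡∣U∣ = inj₂ (KTree∧∣U∣≡1+k⇒KClique[U-x] t (≡.sym 1+k≡∣U∣) (proj₁ sx))

  Simplicial-independent : KTree G k U → suc k < ∣ U ∣ →
                           Simplicial G k U x → Simplicial G k U y → ¬ Adj G x y
  Simplicial-independent t 1+k<∣U∣ sx sy@(y∈U , _) =
    KTree[U-y]⇒¬Adj-Simplicial y∈U (KTree-remove-Simplicial t sy 1+k<∣U∣) sx

  Simplicial? : ∀ U x → Dec (Simplicial G k U x)
  Simplicial? U x = (x ∈? U) ×-dec (IsClique? (nbr G U x) ×-dec (∣ nbr G U x ∣ Data.Nat.≟ k))

  simplicials : Subset n → Subset n
  simplicials U = tabulate (λ x → does (Simplicial? U x))

  ∈simplicials⁻ : x ∈ simplicials U → Simplicial G k U x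
  ∈simplicials⁻ {x} {U} x∈ = toWitness (Equivalence.from T-≡ (trans (isYes≗does (Simplicial? U x)) (∈tabulate⁻ x∈)))

  ∈simplicials⁺ : Simplicial G k U x → x ∈ simplicials U
  ∈simplicials⁺ sx = ∈tabulate⁺ (dec-true (Simplicial? _ _) sx)

  KTree-─-Simplicials : KTree G k U → suc k < ∣ U ∣ → ∀ T → (∀ {x} → x ∈ T → Simplicial G k U x) →
                        KTree G k (U ─ T) ⊎ KClique (U ─ T)
  KTree-─-Simplicials {U} t 1+k<∣U∣ = All.wfRec ⊂-wellFounded _ Removable remove
    where
    Removable : Subset n → Set
    Removable T = (∀ {x} → x ∈ T → Simplicial G k U x) → KTree G k (U ─ T) ⊎ KClique (U ─ T)
    remove : ∀ T → WfRec _⊂_ Removable T → Removable T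
    remove T _ _ with nonempty? T
    remove T _ _ | no T-empty =
      inj₁ (subst (KTree G k) (≡.sym (trans (cong (U ─_) (Empty-unique T-empty)) (p─⊥≡p U))) t)
    remove T rec simplicial | yes (x , x∈T) =
      [ (λ tH → subst (λ V → KTree G k V ⊎ KClique V) H-x≡U─T (KTree-remove-Simplicial′ tH sx))
      , (λ KH → ⊥-elim (KClique⇒¬Simplicial KH sx)) ]′
      (rec (x∈p⇒p-x⊂p x∈T) (simplicial ∘ x∈p-y⇒x∈p))
      where
      H : Subset n
      H = U ─ (T - x)
      H-x≡U─T : H - x ≡ U ─ T
      H-x≡U─T = trans (p─q─r≡p─q∪r U (T - x) ⁅ x ⁆) (cong (U ─_) (x∈p⇒p-x∪⁅x⁆≡p x∈T))
      -- x keeps all its neighbours in H, since simplicial vertices are pairwise nonadjacent.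
      sx : Simplicial G k H x
      sx = Simplicial-resp-nbr (x∈p∧x∉q⇒x∈p─q (proj₁ (simplicial x∈T)) λ x∈T-x → x∈p-y⇒x≢y x∈T-x refl)
             (nbr-restrict (p─q⊆p U (T - x)) λ w∈U x~w → x∈p∧x∉q⇒x∈p─q w∈U λ w∈T-x →
               Simplicial-independent t 1+k<∣U∣ (simplicial x∈T) (simplicial (x∈p-y⇒x∈p w∈T-x)) x~w)
             (simplicial x∈T)

  module Decomposition {U : Subset n} (t : KTree G k U) (1+k<∣U∣ : suc k < ∣ U ∣) where

    L : Subset n
    L = simplicials U

    ⊆L⇒IsIndependent : ∀ {T} → T ⊆ L → IsIndependent G T
    ⊆L⇒IsIndependent T⊆L _ _ a∈T b∈T =
      Simplicial-independent t 1+k<∣U∣ (∈simplicials⁻ (T⊆L a∈T)) (∈simplicials⁻ (T⊆L b∈T))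

    module _ {v : Fin n} (sv : Simplicial G k (U ─ L) v) where

      S : Subset n
      S = nbr G L v

      S⊆L : S ⊆ L
      S⊆L = proj₁ ∘ ∈nbr⁻ {U = L}

      private
        v∈U : v ∈ U
        v∈U = p─q⊆p U L (proj₁ sv)

        v∉L : v ∉ L
        v∉L = x∈p─q⇒x∉q (proj₁ sv)

      S-nonempty : Nonempty S
      S-nonempty with nonempty? S
      ... | yes S-nonempty = S-nonempty
      ... | no  S-empty    = ⊥-elim (v∉L (∈simplicials⁺ (Simplicial-resp-nbr v∈U nbr[U─L]≡nbr[U] sv)))
        where
        nbr[U─L]≡nbr[U] : nbr G U v ≡ nbr G (U ─ L) v
        nbr[U─L]≡nbr[U] = ≡.sym (nbr-restrict (p─q⊆p U L) λ w∈U v~w →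
          x∈p∧x∉q⇒x∈p─q w∈U λ w∈L → S-empty (_ , ∈nbr⁺ w∈L v~w))

      Simplicial[U─S] : Simplicial G k (U ─ S) v
      Simplicial[U─S] = Simplicial-resp-nbr (x∈p∧x∉q⇒x∈p─q v∈U (v∉L ∘ S⊆L)) (≡.sym nbr[U─L]≡nbr[U─S]) sv
        where
        U─L⊆U─S : U ─ L ⊆ U ─ S
        U─L⊆U─S w∈ = x∈p∧x∉q⇒x∈p─q (p─q⊆p U L w∈) (x∈p─q⇒x∉q w∈ ∘ S⊆L)
        nbr[U─L]≡nbr[U─S] : nbr G (U ─ L) v ≡ nbr G (U ─ S) v
        nbr[U─L]≡nbr[U─S] = nbr-restrict U─L⊆U─S λ w∈ v~w →
          x∈p∧x∉q⇒x∈p─q (p─q⊆p U S w∈) λ w∈L → x∈p─q⇒x∉q w∈ (∈nbr⁺ w∈L v~w)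

      nbr[w]≡N[v]-u : ∀ w → w ∈ S →
        Σ (Fin n) λ u →
          (u ∈ nbr G (U ─ S) v × nbr G U w ≡ (nbr G (U ─ S) v ∪ ⁅ v ⁆) - u) ×
          (∀ u′ → u′ ∈ nbr G (U ─ S) v → nbr G U w ≡ (nbr G (U ─ S) v ∪ ⁅ v ⁆) - u′ → u′ ≡ u)
      nbr[w]≡N[v]-u w w∈S with ∈simplicials⁻ (S⊆L w∈S)
      ... | _ , N[w]-clique , ∣N[w]∣≡k =
        q⊆p∪⁅v⁆⇒q≡p∪⁅v⁆-u v∉N[v] v∈N[w] N[w]⊆N[v] (trans ∣N[w]∣≡k (≡.sym (proj₂ (proj₂ Simplicial[U─S]))))
        where
        v∉N[v] : v ∉ nbr G (U ─ S) v
        v∉N[v] v∈ = Adj⇒≢ (proj₂ (∈nbr⁻ {U = U ─ S} v∈)) refl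
        v∈N[w] : v ∈ nbr G U w
        v∈N[w] = ∈nbr⁺ v∈U (Adj-sym (proj₂ (∈nbr⁻ {U = L} w∈S)))
        N[w]⊆N[v] : nbr G U w ⊆ nbr G (U ─ S) v ∪ ⁅ v ⁆
        N[w]⊆N[v] {z} z∈ with z ≟ v | ∈nbr⁻ {U = U} z∈
        ... | yes refl | _          = x∈p∪q⁺ (inj₂ (x∈⁅x⁆ v))
        ... | no  z≢v  | z∈U , w~z  = x∈p∪q⁺ (inj₁ (∈nbr⁺ (x∈p∧x∉q⇒x∈p─q z∈U z∉S) (Adj-sym z~v)))
          where
          z~v : Adj G z v
          z~v = N[w]-clique z v z∈ v∈N[w] z≢v
          z∉S : z ∉ S
          z∉S z∈S = ⊆L⇒IsIndependent S⊆L w z w∈S z∈S w~z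

      ¬Adj-Simplicial∉S : ∀ x → Simplicial G k U x → x ∉ S → Adj G x v → ⊥
      ¬Adj-Simplicial∉S x sx x∉S x~v = x∉S (∈nbr⁺ (∈simplicials⁺ sx) (Adj-sym x~v))

lemma1 : (k : ℕ) → k ≥ 1 → (n : ℕ) → (G : Graph n) → KTree G k ⊤ →
    Σ (Subset n) λ S →
      Nonempty S × IsIndependent G S × (∀ w → w ∈ S → Simplicial G k ⊤ w) ×
      ((∣ ⊤ ─ S ∣ ≡ k × IsClique G (⊤ ─ S))
       ⊎
       (KTree G k (⊤ ─ S) ×
        Σ (Fin n) λ v →
          Simplicial G k (⊤ ─ S) v ×
          (∀ w → w ∈ S →
            Σ (Fin n) λ u →
              (u ∈ nbr G (⊤ ─ S) v × nbr G ⊤ w ≡ (nbr G (⊤ ─ S) v ∪ ⁅ v ⁆) - u) ×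
              (∀ u′ → u′ ∈ nbr G (⊤ ─ S) v →
                nbr G ⊤ w ≡ (nbr G (⊤ ─ S) v ∪ ⁅ v ⁆) - u′ → u′ ≡ u)) ×
          (∀ x → Simplicial G k ⊤ x → x ∉ S → Adj G x v → ⊥)))
-- The argument does not need k ≥ 1.
lemma1 k _ n G t = case m≤n⇒m<n∨m≡n (KTree⇒k<∣U∣ t) of λ where
    (inj₂ 1+k≡n) → let (x , sx) = KTree⇒∃Simplicial t in
      ⁅ x ⁆ , (x , x∈⁅x⁆ x) , IsIndependent-⁅x⁆ ,
      (λ w w∈⁅x⁆ → subst (Simplicial G k ⊤) (≡.sym (x∈⁅y⁆⇒x≡y x w∈⁅x⁆)) sx) ,
      inj₁ (KTree∧∣U∣≡1+k⇒KClique[U-x] t (≡.sym 1+k≡n) ∈⊤)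
    (inj₁ 1+k<n) → let open Decomposition t 1+k<n in
      case KTree-─-Simplicials t 1+k<n L ∈simplicials⁻ of λ where
        (inj₂ L-removed) →
          L , map₂ ∈simplicials⁺ (KTree⇒∃Simplicial t) , ⊆L⇒IsIndependent id , (λ _ → ∈simplicials⁻) ,
          inj₁ L-removed
        (inj₁ tH) → let (v , sv) = KTree⇒∃Simplicial tH in
          S sv , S-nonempty sv , ⊆L⇒IsIndependent (S⊆L sv) , (λ _ → ∈simplicials⁻ ∘ S⊆L sv) ,
          [ (λ tS → inj₂ (tS , v , Simplicial[U─S] sv , nbr[w]≡N[v]-u sv , ¬Adj-Simplicial∉S sv)) , inj₁ ]′
            (KTree-─-Simplicials t 1+k<n (S sv) (∈simplicials⁻ ∘ S⊆L sv))
  where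
  open GraphProperties G
  open KTreeProperties G k
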